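{- Let $p_1,q_1,p_2,q_2$ be non-negative integers with $p_1>0$, $q_2>0$ and $p_1q_2-q_1p_2>0$. The set of $\mathcal{P}$-positions of Rational Nim is $$\mathcal{P}(\mathrm{RN})=\{(x+n(p_1+p_2),\ y+n(q_1+q_2))\mid (x,y)\in\mathcal{T}_Q,\ n\in\mathbb{Z}_{\ge 0}\}.$$ The set $\mathcal{P}(\mathrm{RW})$ of $\mathcal{P}$-positions of Rational Wythoff Nim consists of all positions of the forms $$(x+p_1\lfloor\phi^2n\rfloor+p_2\lfloor\phi n\rfloor,\ y+q_1\lfloor\phi^2n\rfloor+q_2\lfloor\phi n\rfloor)$$ and $$(x+p_1\lfloor\phi n\rfloor+p_2\lfloor\phi^2 n\rfloor,\ y+q_1\lfloor\phi n\rfloor+q_2\lfloor\phi^2 n\rfloor),$$ where $(x,y)\in\mathcal{T}_Q$, $n$ is a non-negative integer and $\phi=\frac{1+\sqrt5}{2}$.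
   Context: Games are impartial under normal play (a player unable to move loses); $\mathcal{P}$-positions are those from which the previous player wins: a position is a $\mathcal{P}$-position iff none of its options is. Let $\mathcal{B}$ be the set of ordered pairs of non-negative integers, and $\mathcal{B}_Q=\{(X,Y)\in\mathcal{B}\mid Xq_1\le Yp_1 \text{ and } Yp_2\le Xq_2\}$. For $\mathcal{M}\subseteq\mathcal{B}\setminus\{(0,0)\}$, the $Q$-subtraction game $G_Q(\mathcal{M})$ has positions $\mathcal{B}_Q$ and moves $(X,Y)\to(X-p_1s-p_2t,\ Y-q_1s-q_2t)$ for $(s,t)\in\mathcal{M}$ whenever the result lies in $\mathcal{B}_Q$. Rational Nim (RN) is $G_Q(\mathcal{M})$ with $\mathcal{M}=\{(0,t),(t,0)\mid t>0\}$ (i.e. moves $(X,Y)\to(X-p_it,Y-q_it)$, $i\in\{1,2\}$, $t\ge1$). Rational Wythoff Nim (RW) is $G_Q(\mathcal{M})$ with $\mathcal{M}=\{(0,t),(t,0),(t,t)\mid t>0\}$. Let $\mathcal{T}_Q=\{(x,y)\in\mathcal{B}_Q\mid p_1(y-q_2)<q_1(x-p_2)\text{ and } p_2(y-q_1)>q_2(x-p_1)\}$. -}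

module Defs where

open import Data.Nat using (ℕ; zero; suc; _+_; _*_; _≤_; _<_)
open import Data.Integer as ℤ using (ℤ; +_; _-_)
open import Data.Product using (Σ; ∃; ∃-syntax; _×_; _,_)
open import Data.Sum using (_⊎_)
open import Relation.Binary.PropositionalEquality using (_≡_)

InBQ : (p₁ q₁ p₂ q₂ : ℕ) → ℕ → ℕ → Set
InBQ p₁ q₁ p₂ q₂ X Y = (X * q₁ ≤ Y * p₁) × (Y * p₂ ≤ X * q₂)

MoveSet : Set₁
MoveSet = ℕ → ℕ → Set

-- Move of G_Q(𝓜): (X,Y) → (X',Y') where X = X' + p₁ s + p₂ t,
-- Y = Y' + q₁ s + q₂ t for some (s,t) ∈ 𝓜, and (X',Y') ∈ 𝓑_Q.
-- (Stated additively to avoid truncated subtraction; equivalent to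
--  X' = X - p₁ s - p₂ t, Y' = Y - q₁ s - q₂ t landing in 𝓑_Q.)
Move : (p₁ q₁ p₂ q₂ : ℕ) → MoveSet → ℕ → ℕ → ℕ → ℕ → Set
Move p₁ q₁ p₂ q₂ M X Y X' Y' =
  InBQ p₁ q₁ p₂ q₂ X' Y' ×
  (∃[ s ] ∃[ t ] (M s t × (X ≡ X' + p₁ * s + p₂ * t) × (Y ≡ Y' + q₁ * s + q₂ * t)))

mutual
  data IsP (p₁ q₁ p₂ q₂ : ℕ) (M : MoveSet) (X Y : ℕ) : Set where
    allOptionsN : (∀ X' Y' → Move p₁ q₁ p₂ q₂ M X Y X' Y' → IsN p₁ q₁ p₂ q₂ M X' Y')
                → IsP p₁ q₁ p₂ q₂ M X Y

  data IsN (p₁ q₁ p₂ q₂ : ℕ) (M : MoveSet) (X Y : ℕ) : Set where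
    someOptionP : ∀ X' Y' → Move p₁ q₁ p₂ q₂ M X Y X' Y' → IsP p₁ q₁ p₂ q₂ M X' Y'
                → IsN p₁ q₁ p₂ q₂ M X Y

PPos : (p₁ q₁ p₂ q₂ : ℕ) → MoveSet → ℕ → ℕ → Set
PPos p₁ q₁ p₂ q₂ M X Y = InBQ p₁ q₁ p₂ q₂ X Y × IsP p₁ q₁ p₂ q₂ M X Y

RN-moves : MoveSet
RN-moves s t = (s ≡ 0 × 0 < t) ⊎ (t ≡ 0 × 0 < s)

RW-moves : MoveSet
RW-moves s t = (s ≡ 0 × 0 < t) ⊎ (t ≡ 0 × 0 < s) ⊎ (s ≡ t × 0 < t)

InTQ : (p₁ q₁ p₂ q₂ : ℕ) → ℕ → ℕ → Set
InTQ p₁ q₁ p₂ q₂ x y =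
  InBQ p₁ q₁ p₂ q₂ x y ×
  ((+ p₁) ℤ.* (+ y - + q₂) ℤ.< (+ q₁) ℤ.* (+ x - + p₂)) ×
  ((+ q₂) ℤ.* (+ x - + p₁) ℤ.< (+ p₂) ℤ.* (+ y - + q₁))

-- Comparisons with m·√5 (m : ℕ) for an integer z, without reals:
-- z ≤ m√5  ⇔  z ≤ 0 or z² ≤ 5m²
LeSqrt5 : ℤ → ℕ → Set
LeSqrt5 z m = (z ℤ.≤ + 0) ⊎ (z ℤ.* z ℤ.≤ + (5 * m * m))

-- m√5 < z  ⇔  z > 0 and 5m² < z²
LtSqrt5 : ℕ → ℤ → Set
LtSqrt5 m z = (+ 0 ℤ.< z) × (+ (5 * m * m) ℤ.< z ℤ.* z)

-- FloorPhi n k : k = ⌊φ n⌋ with φ = (1+√5)/2,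
--   i.e. k ≤ (n + n√5)/2 < k+1, i.e. 2k - n ≤ n√5 < 2k + 2 - n.
FloorPhi : ℕ → ℕ → Set
FloorPhi n k = LeSqrt5 (+ (2 * k) - + n) n × LtSqrt5 n (+ (2 * k + 2) - + n)

-- FloorPhi² n k : k = ⌊φ² n⌋ with φ² = (3+√5)/2,
--   i.e. 2k - 3n ≤ n√5 < 2k + 2 - 3n.
FloorPhi² : ℕ → ℕ → Set
FloorPhi² n k = LeSqrt5 (+ (2 * k) - + (3 * n)) n × LtSqrt5 n (+ (2 * k + 2) - + (3 * n))

RN-Set : (p₁ q₁ p₂ q₂ : ℕ) → ℕ → ℕ → Set
RN-Set p₁ q₁ p₂ q₂ X Y =
  ∃[ x ] ∃[ y ] ∃[ n ] (InTQ p₁ q₁ p₂ q₂ x y ×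
    (X ≡ x + n * (p₁ + p₂)) × (Y ≡ y + n * (q₁ + q₂)))

RW-Set : (p₁ q₁ p₂ q₂ : ℕ) → ℕ → ℕ → Set
RW-Set p₁ q₁ p₂ q₂ X Y =
  ∃[ x ] ∃[ y ] ∃[ n ] ∃[ a ] ∃[ b ] (InTQ p₁ q₁ p₂ q₂ x y × FloorPhi² n a × FloorPhi n b ×
    (((X ≡ x + p₁ * a + p₂ * b) × (Y ≡ y + q₁ * a + q₂ * b)) ⊎
     ((X ≡ x + p₁ * b + p₂ * a) × (Y ≡ y + q₁ * b + q₂ * a))))

module Submission where

-- Let D = p₁q₂ − q₁p₂ > 0. The gaps u = Xq₂ − Yp₂ and v = Yp₁ − Xq₁ of a position of 𝓑_Q satisfy
-- D·(X , Y) = u·(p₁ , q₁) + v·(p₂ , q₂), and a translation by s·(p₁ , q₁) + t·(p₂ , q₂) adds (sD , tD)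
-- to them. Dividing the gaps by D thus writes every position uniquely as a point of 𝓣_Q (both gaps below D)
-- plus s·(p₁ , q₁) + t·(p₂ , q₂), and a move of G_Q(𝓜) changes only (s , t), by a move of the plain
-- subtraction game 𝓜 on ℕ². So 𝓟(G_Q(𝓜)) is 𝓣_Q plus the 𝓟-positions of 𝓜: the diagonal for Nim, and
-- the pairs {⌊φn⌋ , ⌊φn⌋ + n} for Wythoff Nim. The latter rests on the lower and upper Wythoff sequences
-- partitioning ℕ (Beatty), which only needs φ² = φ + 1 and the irrationality of φ.

open import Defs
open import Data.List using ([]; _∷_)
open import Data.Nat
open import Data.Nat.DivMod using (_/_; _%_; m≡m%n+[m/n]*n; m%n<n; m<n⇒m/n≡0; m*n/n≡m; +-distrib-/-∣ʳ)
open import Data.Nat.Divisibility using (n∣m*n)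
open import Data.Nat.Induction using (<-rec; <-wellFounded)
open import Data.Nat.Properties
open import Data.Nat.Tactic.RingSolver using (solve; solve-∀)
open import Algebra.Properties.CommutativeSemigroup +-commutativeSemigroup using (xy∙z≈xz∙y)
open import Data.Integer as ℤ using (ℤ; +_; +≤+; +<+; _⊖_)
import Data.Integer.Properties as ℤ
open import Data.Integer.Tactic.RingSolver using () renaming (solve-∀ to ℤ-solve-∀)
open import Data.Product using (∃; ∃₂; ∃-syntax; _×_; _,_; proj₁; proj₂)
open import Data.Product.Function.NonDependent.Propositional using (_×-⇔_)
open import Data.Sum using (_⊎_; inj₁; inj₂)
open import Data.Empty using (⊥; ⊥-elim)
open import Data.Unit using (⊤; tt)
open import Function.Base using (id; case_of_)
open import Function.Bundles using (_⇔_; mk⇔; Equivalence)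
import Function.Properties.Equivalence as ⇔
open import Induction.WellFounded using (Acc; acc)
open import Relation.Nullary using (¬_; yes; no)
open import Relation.Nullary.Negation using (contradiction)
open import Relation.Unary using (Decidable)
open import Relation.Binary.PropositionalEquality
open import Relation.Binary.Definitions using (tri<; tri≈; tri>)

Relation₄ : Set₁
Relation₄ = ℕ → ℕ → ℕ → ℕ → Set

Independent : Relation₄ → (ℕ → ℕ → Set) → Set
Independent R K = ∀ {X Y X′ Y′} → K X Y → R X Y X′ Y′ → ¬ K X′ Y′

Absorbing : (ℕ → ℕ → Set) → Relation₄ → (ℕ → ℕ → Set) → Set
Absorbing Pos R K = ∀ {X Y} → Pos X Y → K X Y ⊎ ∃₂ λ X′ Y′ → R X Y X′ Y′ × K X′ Y′

BaseMove : MoveSet → Relation₄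
BaseMove M s t s′ t′ = ∃₂ λ i j → M i j × s ≡ s′ + i × t ≡ t′ + j

Everywhere : ℕ → ℕ → Set
Everywhere _ _ = ⊤

IsP⇒¬IsN : ∀ {p₁ q₁ p₂ q₂ M X Y} → IsP p₁ q₁ p₂ q₂ M X Y → ¬ IsN p₁ q₁ p₂ q₂ M X Y
IsP⇒¬IsN (allOptionsN allN) (someOptionP X′ Y′ m isP) = IsP⇒¬IsN isP (allN X′ Y′ m)

module Kernel (p₁ q₁ p₂ q₂ : ℕ) (M : MoveSet) (K : ℕ → ℕ → Set)
  (move-decreasing : ∀ {X Y X′ Y′} → Move p₁ q₁ p₂ q₂ M X Y X′ Y′ → X′ + Y′ < X + Y)
  (K⊆InBQ : ∀ {X Y} → K X Y → InBQ p₁ q₁ p₂ q₂ X Y)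
  (K-independent : Independent (Move p₁ q₁ p₂ q₂ M) K)
  (K-absorbing : Absorbing (InBQ p₁ q₁ p₂ q₂) (Move p₁ q₁ p₂ q₂ M) K)
  where

  private
    kernel⇒IsP : ∀ {X Y} → Acc _<_ (X + Y) → K X Y → IsP p₁ q₁ p₂ q₂ M X Y
    kernel⇒IsP (acc rec) k = allOptionsN option⇒IsN
      where
      option⇒IsN : ∀ X′ Y′ → Move p₁ q₁ p₂ q₂ M _ _ X′ Y′ → IsN p₁ q₁ p₂ q₂ M X′ Y′
      option⇒IsN X′ Y′ m with K-absorbing (proj₁ m)
      ... | inj₁ k′ = ⊥-elim (K-independent k m k′)
      ... | inj₂ (X″ , Y″ , m′ , k″) =
        someOptionP X″ Y″ m′ (kernel⇒IsP (rec (<-trans (move-decreasing m′) (move-decreasing m))) k″)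

  PPos⇔kernel : ∀ X Y → PPos p₁ q₁ p₂ q₂ M X Y ⇔ K X Y
  PPos⇔kernel X Y = mk⇔ to (λ k → K⊆InBQ k , kernel⇒IsP (<-wellFounded _) k)
    where
    to : PPos p₁ q₁ p₂ q₂ M X Y → K X Y
    to (inBQ , isP) with K-absorbing inBQ
    ... | inj₁ k = k
    ... | inj₂ (X′ , Y′ , m , k′) =
      ⊥-elim (IsP⇒¬IsN isP (someOptionP X′ Y′ m (kernel⇒IsP (<-wellFounded _) k′)))

[r+s*D]/D≡s : ∀ {r s D} .{{_ : NonZero D}} → r < D → (r + s * D) / D ≡ s
[r+s*D]/D≡s {r} {s} {D} r<D = begin
  (r + s * D) / D     ≡⟨ +-distrib-/-∣ʳ r (n∣m*n s) ⟩
  r / D + s * D / D   ≡⟨ cong₂ _+_ (m<n⇒m/n≡0 r<D) (m*n/n≡m s D) ⟩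
  s                   ∎
  where open ≡-Reasoning

quotient-unique : ∀ {r r′ s s′ D} .{{_ : NonZero D}} → r < D → r′ < D → r + s * D ≡ r′ + s′ * D → s ≡ s′
quotient-unique {r} {r′} {s} {s′} {D} r<D r′<D eq =
  trans (sym ([r+s*D]/D≡s r<D)) (trans (cong (_/ D) eq) ([r+s*D]/D≡s r′<D))

*-split : ∀ {X R P D} .{{_ : NonZero D}} → X * D ≡ R + P * D → ∃[ x ] X ≡ x + P × x * D ≡ R
*-split {X} {R} {P} {D} XD≡R+PD with m≤n⇒∃[o]m+o≡n P≤X
  where
  P≤X : P ≤ X
  P≤X = *-cancelʳ-≤ P X D (≤-trans (m≤n+m (P * D) R) (≤-reflexive (sym XD≡R+PD)))
... | x , refl = x , +-comm P x , +-cancelʳ-≡ (P * D) (x * D) R (begin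
  x * D + P * D ≡⟨ solve (x ∷ P ∷ D ∷ []) ⟩
  (P + x) * D   ≡⟨ XD≡R+PD ⟩
  R + P * D     ∎)
  where open ≡-Reasoning

+a*[+b-+c] : ∀ a b c → + a ℤ.* (+ b ℤ.- + c) ≡ + (a * b) ℤ.- + (a * c)
+a*[+b-+c] a b c = trans (distrib (+ a) (+ b) (+ c)) (sym (cong₂ ℤ._-_ (ℤ.pos-* a b) (ℤ.pos-* a c)))
  where
  distrib : ∀ (A B C : ℤ) → A ℤ.* (B ℤ.- C) ≡ A ℤ.* B ℤ.- A ℤ.* C
  distrib = ℤ-solve-∀

[+a-+b]<[+c-+d]⇔ : ∀ a b c d → (+ a ℤ.- + b ℤ.< + c ℤ.- + d) ⇔ (a + d < c + b)
[+a-+b]<[+c-+d]⇔ a b c d = mk⇔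
  (λ lt → ℤ.drop‿+<+ (subst₂ ℤ._<_ (trans (cancel₁ (+ a) (+ b) (+ d)) (sym (ℤ.pos-+ a d)))
                                  (trans (cancel₂ (+ c) (+ d) (+ b)) (sym (ℤ.pos-+ c b)))
                                  (ℤ.+-monoˡ-< (+ b ℤ.+ + d) lt)))
  (λ lt → subst₂ ℤ._<_ (trans (cong (ℤ._+ (ℤ.- + b ℤ.- + d)) (ℤ.pos-+ a d)) (cancel₃ (+ a) (+ d) (+ b)))
                       (trans (cong (ℤ._+ (ℤ.- + b ℤ.- + d)) (ℤ.pos-+ c b)) (cancel₄ (+ c) (+ b) (+ d)))
                       (ℤ.+-monoˡ-< (ℤ.- + b ℤ.- + d) (+<+ lt)))
  where
  cancel₁ : ∀ A B D → (A ℤ.- B) ℤ.+ (B ℤ.+ D) ≡ A ℤ.+ D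
  cancel₁ = ℤ-solve-∀
  cancel₂ : ∀ C D B → (C ℤ.- D) ℤ.+ (B ℤ.+ D) ≡ C ℤ.+ B
  cancel₂ = ℤ-solve-∀
  cancel₃ : ∀ A D B → (A ℤ.+ D) ℤ.+ (ℤ.- B ℤ.- D) ≡ A ℤ.- B
  cancel₃ = ℤ-solve-∀
  cancel₄ : ∀ C B D → (C ℤ.+ B) ℤ.+ (ℤ.- B ℤ.- D) ≡ C ℤ.- D
  cancel₄ = ℤ-solve-∀

-- A position (X , Y) with gaps Y c + u = X d and X b + v = Y a from the two boundary rays
-- has coordinates (u / D , v / D) in the basis (a , b), (c , d), where D = ad − bc.
module Gaps (a b c d D : ℕ) (det : a * d ≡ b * c + D) where

  gaps⇒*D : ∀ {X Y u v} → Y * c + u ≡ X * d → X * b + v ≡ Y * a → X * D ≡ a * u + c * v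
  gaps⇒*D {X} {Y} {u} {v} gapᵤ gapᵥ = +-cancelˡ-≡ (Y * a * c) _ _ (begin
    Y * a * c + X * D           ≡⟨ cong (λ w → w * c + X * D) gapᵥ ⟨
    (X * b + v) * c + X * D     ≡⟨ solve (X ∷ b ∷ v ∷ c ∷ D ∷ []) ⟩
    X * (b * c + D) + c * v     ≡⟨ cong (λ w → X * w + c * v) det ⟨
    X * (a * d) + c * v         ≡⟨ solve (X ∷ a ∷ d ∷ c ∷ v ∷ []) ⟩
    a * (X * d) + c * v         ≡⟨ cong (λ w → a * w + c * v) gapᵤ ⟨
    a * (Y * c + u) + c * v     ≡⟨ solve (a ∷ Y ∷ c ∷ u ∷ v ∷ []) ⟩
    Y * a * c + (a * u + c * v) ∎)
    where open ≡-Reasoning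

  gapᵥ<D⇔ : ∀ {X Y v} → X * b + v ≡ Y * a →
           (+ a ℤ.* (+ Y ℤ.- + d) ℤ.< + b ℤ.* (+ X ℤ.- + c)) ⇔ v < D
  gapᵥ<D⇔ {X} {Y} {v} gapᵥ =
    ⇔.trans integer-form (subst₂ (λ l r → (l < r) ⇔ v < D) (sym aY+bc) (sym bX+ad) cancel)
    where
    integer-form : (+ a ℤ.* (+ Y ℤ.- + d) ℤ.< + b ℤ.* (+ X ℤ.- + c)) ⇔ (a * Y + b * c < b * X + a * d)
    integer-form = subst₂ (λ l r → (l ℤ.< r) ⇔ (a * Y + b * c < b * X + a * d))
                          (sym (+a*[+b-+c] a Y d)) (sym (+a*[+b-+c] b X c))
                          ([+a-+b]<[+c-+d]⇔ (a * Y) (a * d) (b * X) (b * c))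
    cancel : (X * b + b * c + v < X * b + b * c + D) ⇔ v < D
    cancel = mk⇔ (+-cancelˡ-< (X * b + b * c) v D) (+-monoʳ-< (X * b + b * c))
    aY+bc : a * Y + b * c ≡ (X * b + b * c) + v
    aY+bc = trans (cong (_+ b * c) (trans (*-comm a Y) (sym gapᵥ))) (xy∙z≈xz∙y (X * b) v (b * c))
    bX+ad : b * X + a * d ≡ (X * b + b * c) + D
    bX+ad = trans (cong₂ _+_ (*-comm b X) det) (sym (+-assoc (X * b) (b * c) D))

  *D⇒gapᵤ : ∀ {X Y u v} .{{_ : NonZero D}} →
            X * D ≡ a * u + c * v → Y * D ≡ b * u + d * v → Y * c + u ≡ X * d
  *D⇒gapᵤ {X} {Y} {u} {v} XD YD = *-cancelʳ-≡ _ _ D (begin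
    (Y * c + u) * D             ≡⟨ solve (Y ∷ c ∷ u ∷ D ∷ []) ⟩
    c * (Y * D) + u * D         ≡⟨ cong (λ w → c * w + u * D) YD ⟩
    c * (b * u + d * v) + u * D ≡⟨ solve (c ∷ b ∷ u ∷ d ∷ v ∷ D ∷ []) ⟩
    (b * c + D) * u + c * d * v ≡⟨ cong (λ w → w * u + c * d * v) det ⟨
    a * d * u + c * d * v       ≡⟨ solve (a ∷ d ∷ u ∷ c ∷ v ∷ []) ⟩
    d * (a * u + c * v)         ≡⟨ cong (d *_) XD ⟨
    d * (X * D)                 ≡⟨ solve (d ∷ X ∷ D ∷ []) ⟩
    X * d * D                   ∎)
    where open ≡-Reasoning

private
  shift-+ : ∀ x a c s t i j → x + a * s + c * t + a * i + c * j ≡ x + a * (s + i) + c * (t + j)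
  shift-+ = solve-∀

module QCoordinates (p₁ q₁ p₂ q₂ D : ℕ) .{{_ : NonZero D}} (det : p₁ * q₂ ≡ q₁ * p₂ + D) where

  shiftX : ℕ → ℕ → ℕ → ℕ
  shiftX x s t = x + p₁ * s + p₂ * t

  shiftY : ℕ → ℕ → ℕ → ℕ
  shiftY y s t = y + q₁ * s + q₂ * t

  shiftX-+ : ∀ x s t i j → shiftX (shiftX x s t) i j ≡ shiftX x (s + i) (t + j)
  shiftX-+ x s t i j = shift-+ x p₁ p₂ s t i j

  shiftY-+ : ∀ y s t i j → shiftY (shiftY y s t) i j ≡ shiftY y (s + i) (t + j)
  shiftY-+ y s t i j = shift-+ y q₁ q₂ s t i j

  record HasGaps (X Y u v : ℕ) : Set where
    constructor mkGaps
    field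
      gapᵤ : Y * p₂ + u ≡ X * q₂
      gapᵥ : X * q₁ + v ≡ Y * p₁

  record InT (x y : ℕ) : Set where
    constructor mkInT
    field
      u v  : ℕ
      gaps : HasGaps x y u v
      u<D  : u < D
      v<D  : v < D

  private
    det′ : q₂ * p₁ ≡ p₂ * q₁ + D
    det′ = trans (*-comm q₂ p₁) (trans det (cong (_+ D) (*-comm q₁ p₂)))

  open Gaps p₁ q₁ p₂ q₂ D det using (gaps⇒*D; *D⇒gapᵤ; gapᵥ<D⇔)
  open Gaps q₂ p₂ q₁ p₁ D det′ renaming (gaps⇒*D to gaps⇒*D′; *D⇒gapᵤ to *D⇒gapᵤ′; gapᵥ<D⇔ to gapᵥ<D⇔′)

  HasGaps⇔*D : ∀ X Y u v → HasGaps X Y u v ⇔ (X * D ≡ p₁ * u + p₂ * v × Y * D ≡ q₁ * u + q₂ * v)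
  HasGaps⇔*D X Y u v = mk⇔
    (λ (mkGaps gapᵤ gapᵥ) → gaps⇒*D {X} {Y} gapᵤ gapᵥ ,
                       trans (gaps⇒*D′ {Y} {X} gapᵥ gapᵤ) (+-comm (q₂ * v) (q₁ * u)))
    (λ (XD , YD) → mkGaps (*D⇒gapᵤ {X} {Y} XD YD)
                          (*D⇒gapᵤ′ {Y} {X} (trans YD (+-comm (q₁ * u) (q₂ * v)))
                                             (trans XD (+-comm (p₁ * u) (p₂ * v)))))

  HasGaps⇒InBQ : ∀ {X Y u v} → HasGaps X Y u v → InBQ p₁ q₁ p₂ q₂ X Y
  HasGaps⇒InBQ {X} {Y} {u} {v} (mkGaps gapᵤ gapᵥ) =
    subst (X * q₁ ≤_) gapᵥ (m≤m+n (X * q₁) v) , subst (Y * p₂ ≤_) gapᵤ (m≤m+n (Y * p₂) u)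

  InBQ⇒HasGaps : ∀ {X Y} → InBQ p₁ q₁ p₂ q₂ X Y → ∃₂ (HasGaps X Y)
  InBQ⇒HasGaps (Xq₁≤Yp₁ , Yp₂≤Xq₂) with m≤n⇒∃[o]m+o≡n Xq₁≤Yp₁ | m≤n⇒∃[o]m+o≡n Yp₂≤Xq₂
  ... | v , gapᵥ | u , gapᵤ = u , v , mkGaps gapᵤ gapᵥ

  HasGaps-unique : ∀ {X Y u v u′ v′} → HasGaps X Y u v → HasGaps X Y u′ v′ → u ≡ u′ × v ≡ v′
  HasGaps-unique {X} {Y} (mkGaps gapᵤ gapᵥ) (mkGaps gapᵤ′ gapᵥ′) =
    +-cancelˡ-≡ (Y * p₂) _ _ (trans gapᵤ (sym gapᵤ′)) , +-cancelˡ-≡ (X * q₁) _ _ (trans gapᵥ (sym gapᵥ′))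

  HasGaps-shift : ∀ {x y u v} s t → HasGaps x y u v →
                  HasGaps (shiftX x s t) (shiftY y s t) (u + s * D) (v + t * D)
  HasGaps-shift {x} {y} {u} {v} s t gaps with Equivalence.to (HasGaps⇔*D x y u v) gaps
  ... | xD , yD = Equivalence.from (HasGaps⇔*D (shiftX x s t) (shiftY y s t) (u + s * D) (v + t * D))
                                   (shift {x} p₁ p₂ xD , shift {y} q₁ q₂ yD)
    where
    shift : ∀ {z} a c → z * D ≡ a * u + c * v → (z + a * s + c * t) * D ≡ a * (u + s * D) + c * (v + t * D)
    shift {z} a c zD = begin
      (z + a * s + c * t) * D               ≡⟨ solve (z ∷ a ∷ s ∷ c ∷ t ∷ D ∷ []) ⟩
      z * D + a * s * D + c * t * D         ≡⟨ cong (λ w → w + a * s * D + c * t * D) zD ⟩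
      a * u + c * v + a * s * D + c * t * D ≡⟨ solve (a ∷ u ∷ c ∷ v ∷ s ∷ t ∷ D ∷ []) ⟩
      a * (u + s * D) + c * (v + t * D)     ∎
      where open ≡-Reasoning

  InT-shift-InBQ : ∀ {x y} s t → InT x y → InBQ p₁ q₁ p₂ q₂ (shiftX x s t) (shiftY y s t)
  InT-shift-InBQ s t (mkInT _ _ gaps _ _) = HasGaps⇒InBQ (HasGaps-shift s t gaps)

  coordinates-unique : ∀ {x y s t x′ y′ s′ t′} → InT x y → InT x′ y′ →
                       shiftX x s t ≡ shiftX x′ s′ t′ → shiftY y s t ≡ shiftY y′ s′ t′ → s ≡ s′ × t ≡ t′
  coordinates-unique {s = s} {t} {s′ = s′} {t′} (mkInT u v gaps u<D v<D) (mkInT u′ v′ gaps′ u′<D v′<D) eqX eqY =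
    quotient-unique u<D u′<D (proj₁ same-gaps) , quotient-unique v<D v′<D (proj₂ same-gaps)
    where
    same-gaps : u + s * D ≡ u′ + s′ * D × v + t * D ≡ v′ + t′ * D
    same-gaps = HasGaps-unique
      (subst₂ (λ X Y → HasGaps X Y (u + s * D) (v + t * D)) eqX eqY (HasGaps-shift s t gaps))
      (HasGaps-shift s′ t′ gaps′)

  private
    divide : ∀ a c u v → a * u + c * v ≡ (a * (u % D) + c * (v % D)) + (a * (u / D) + c * (v / D)) * D
    divide a c u v = trans (cong₂ (λ m n → a * m + c * n) (m≡m%n+[m/n]*n u D) (m≡m%n+[m/n]*n v D))
                           (split-linear a c (u % D) (v % D) (u / D) (v / D) D)
      where
      split-linear : ∀ a c r r′ s t D →
                     a * (r + s * D) + c * (r′ + t * D) ≡ (a * r + c * r′) + (a * s + c * t) * D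
      split-linear = solve-∀

  coordinates-exist : ∀ {X Y} → InBQ p₁ q₁ p₂ q₂ X Y →
                      ∃[ x ] ∃[ y ] ∃[ s ] ∃[ t ] InT x y × X ≡ shiftX x s t × Y ≡ shiftY y s t
  coordinates-exist {X} {Y} inBQ with InBQ⇒HasGaps inBQ
  ... | u , v , gaps with Equivalence.to (HasGaps⇔*D X Y u v) gaps
  ...   | XD , YD with *-split (trans XD (divide p₁ p₂ u v)) | *-split (trans YD (divide q₁ q₂ u v))
  ...     | x , X≡x+ , xD | y , Y≡y+ , yD =
    x , y , u / D , v / D ,
    mkInT (u % D) (v % D) (Equivalence.from (HasGaps⇔*D x y (u % D) (v % D)) (xD , yD)) (m%n<n u D) (m%n<n v D) ,
    trans X≡x+ (sym (+-assoc x _ _)) , trans Y≡y+ (sym (+-assoc y _ _))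

  InT⇔InTQ : ∀ {x y} → InT x y ⇔ InTQ p₁ q₁ p₂ q₂ x y
  InT⇔InTQ {x} {y} = mk⇔
    (λ (mkInT u v gaps u<D v<D) → HasGaps⇒InBQ gaps ,
       Equivalence.from (gapᵥ<D⇔ (HasGaps.gapᵥ gaps)) v<D , Equivalence.from (gapᵥ<D⇔′ (HasGaps.gapᵤ gaps)) u<D)
    (λ (inBQ , below₁ , below₂) → case InBQ⇒HasGaps inBQ of λ where
       (u , v , gaps) → mkInT u v gaps (Equivalence.to (gapᵥ<D⇔′ (HasGaps.gapᵤ gaps)) below₂)
                                       (Equivalence.to (gapᵥ<D⇔ (HasGaps.gapᵥ gaps)) below₁))

  Lift : (ℕ → ℕ → Set) → ℕ → ℕ → Set
  Lift W X Y = ∃[ x ] ∃[ y ] ∃[ s ] ∃[ t ] InT x y × W s t × X ≡ shiftX x s t × Y ≡ shiftY y s t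

module Lifting (p₁ q₁ p₂ q₂ D : ℕ) .{{_ : NonZero D}} (det : p₁ * q₂ ≡ q₁ * p₂ + D)
  (0<p₁ : 0 < p₁) (0<q₂ : 0 < q₂)
  (M : MoveSet) (M-nonzero : ∀ {i j} → M i j → 0 < i ⊎ 0 < j)
  (W : ℕ → ℕ → Set)
  (W-independent : Independent (BaseMove M) W)
  (W-absorbing : Absorbing Everywhere (BaseMove M) W)
  where

  open QCoordinates p₁ q₁ p₂ q₂ D det

  move-decreasing : ∀ {X Y X′ Y′} → Move p₁ q₁ p₂ q₂ M X Y X′ Y′ → X′ + Y′ < X + Y
  move-decreasing {X′ = X′} {Y′} (_ , i , j , m , refl , refl) = begin-strict
    X′ + Y′                                           <⟨ m<m+n (X′ + Y′) decrease>0 ⟩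
    X′ + Y′ + ((p₁ * i + q₂ * j) + (p₂ * j + q₁ * i)) ≡⟨ solve (X′ ∷ Y′ ∷ p₁ ∷ i ∷ q₂ ∷ j ∷ p₂ ∷ q₁ ∷ []) ⟩
    (X′ + p₁ * i + p₂ * j) + (Y′ + q₁ * i + q₂ * j)   ∎
    where
    open ≤-Reasoning
    p₁i+q₂j>0 : 0 < i ⊎ 0 < j → 0 < p₁ * i + q₂ * j
    p₁i+q₂j>0 (inj₁ 0<i) = <-≤-trans (*-mono-< 0<p₁ 0<i) (m≤m+n (p₁ * i) (q₂ * j))
    p₁i+q₂j>0 (inj₂ 0<j) = <-≤-trans (*-mono-< 0<q₂ 0<j) (m≤n+m (q₂ * j) (p₁ * i))
    decrease>0 : 0 < (p₁ * i + q₂ * j) + (p₂ * j + q₁ * i)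
    decrease>0 = <-≤-trans (p₁i+q₂j>0 (M-nonzero m)) (m≤m+n _ _)

  Lift⊆InBQ : ∀ {X Y} → Lift W X Y → InBQ p₁ q₁ p₂ q₂ X Y
  Lift⊆InBQ (x , y , s , t , T , _ , refl , refl) = InT-shift-InBQ s t T

  Lift-independent : Independent (Move p₁ q₁ p₂ q₂ M) (Lift W)
  Lift-independent (x , y , s , t , T , w , refl , refl) (_ , i , j , m , eqX , eqY)
                   (x′ , y′ , s′ , t′ , T′ , w′ , refl , refl) =
    W-independent w (i , j , m , proj₁ coordinates , proj₂ coordinates) w′
    where
    coordinates : s ≡ s′ + i × t ≡ t′ + j
    coordinates = coordinates-unique {x} {y} {s} {t} {x′} {y′} {s′ + i} {t′ + j} T T′
                    (trans eqX (shiftX-+ x′ s′ t′ i j)) (trans eqY (shiftY-+ y′ s′ t′ i j))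

  lift-move : ∀ {x y s t s′ t′} → InT x y → BaseMove M s t s′ t′ →
              Move p₁ q₁ p₂ q₂ M (shiftX x s t) (shiftY y s t) (shiftX x s′ t′) (shiftY y s′ t′)
  lift-move {x} {y} {s′ = s′} {t′} T (i , j , m , refl , refl) =
    InT-shift-InBQ s′ t′ T , i , j , m , sym (shiftX-+ x s′ t′ i j) , sym (shiftY-+ y s′ t′ i j)

  Lift-absorbing : Absorbing (InBQ p₁ q₁ p₂ q₂) (Move p₁ q₁ p₂ q₂ M) (Lift W)
  Lift-absorbing {X} {Y} inBQ = case coordinates-exist {X} {Y} inBQ of λ where
    (x , y , s , t , T , refl , refl) → case W-absorbing {s} {t} tt of λ where
      (inj₁ w)                    → inj₁ (x , y , s , t , T , w , refl , refl)
      (inj₂ (s′ , t′ , mv , w′)) → inj₂ (shiftX x s′ t′ , shiftY y s′ t′ , lift-move T mv ,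
                                         (x , y , s′ , t′ , T , w′ , refl , refl))

  open Kernel p₁ q₁ p₂ q₂ M (Lift W) move-decreasing Lift⊆InBQ Lift-independent Lift-absorbing public
    renaming (PPos⇔kernel to PPos⇔Lift)

-- k ≤ φn and c > φn, stated without reals: φ is the positive root of x² = x + 1.
infix 4 _≤φ·_ _>φ·_

_≤φ·_ : ℕ → ℕ → Set
k ≤φ· n = k * k ≤ k * n + n * n

_>φ·_ : ℕ → ℕ → Set
c >φ· n = c * n + n * n < c * c

>φ·⇒> : ∀ {c n} → c >φ· n → n < c
>φ·⇒> {c} {n} c>φn = ≰⇒> λ c≤n → <⇒≱ c>φn (≤-trans (*-monoʳ-≤ c c≤n) (m≤m+n (c * n) (n * n)))

>φ·-mono : ∀ {c c′ n} → c >φ· n → c ≤ c′ → c′ >φ· n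
>φ·-mono {c} {c′} {n} c>φn c≤c′ with m≤n⇒∃[o]m+o≡n c≤c′
... | e , refl = begin-strict
  (c + e) * n + n * n           ≡⟨ solve (c ∷ e ∷ n ∷ []) ⟩
  (c * n + n * n) + e * n       <⟨ +-monoˡ-< (e * n) c>φn ⟩
  c * c + e * n                 ≤⟨ +-monoʳ-≤ (c * c) (*-monoʳ-≤ e (<⇒≤ (>φ·⇒> c>φn))) ⟩
  c * c + e * c                 ≤⟨ m≤m+n (c * c + e * c) (c * e + e * e) ⟩
  c * c + e * c + (c * e + e * e) ≡⟨ solve (c ∷ e ∷ []) ⟩
  (c + e) * (c + e)             ∎
  where open ≤-Reasoning

≤φ·⇒≯φ· : ∀ {k n} → k ≤φ· n → ¬ (k >φ· n)
≤φ·⇒≯φ· k≤φn k>φn = <⇒≱ k>φn k≤φn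

≤φ·-monoʳ : ∀ {k n n′} → k ≤φ· n → n ≤ n′ → k ≤φ· n′
≤φ·-monoʳ {k} k≤φn n≤n′ = ≤-trans k≤φn (+-mono-≤ (*-monoʳ-≤ k n≤n′) (*-mono-≤ n≤n′ n≤n′))

>φ·-antimonoʳ : ∀ {c n n′} → c >φ· n → n′ ≤ n → c >φ· n′
>φ·-antimonoʳ {c} c>φn n′≤n = ≤-<-trans (+-mono-≤ (*-monoʳ-≤ c n′≤n) (*-mono-≤ n′≤n n′≤n)) c>φn

m≤n⇒m*m<m*n+n*n : ∀ {m n} → 0 < n → m ≤ n → m * m < m * n + n * n
m≤n⇒m*m<m*n+n*n {m} {n} 0<n m≤n =
  ≤-<-trans (≤-trans (*-monoʳ-≤ m m≤n) (≤-reflexive (sym (+-identityʳ (m * n)))))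
            (+-monoʳ-< (m * n) (*-mono-< 0<n 0<n))

-- Infinite descent: c² = cn + n² forces c = n + e with n² = ne + e² and 0 < e < n.
φ-irrational : ∀ n {c} → 0 < n → c * c ≢ c * n + n * n
φ-irrational = <-rec _ descent
  where
  descent : ∀ n → (∀ {e} → e < n → ∀ {c} → 0 < e → c * c ≢ c * e + e * e) →
            ∀ {c} → 0 < n → c * c ≢ c * n + n * n
  descent n rec {c} 0<n c²≡cn+n² with m≤n⇒∃[o]m+o≡n (<⇒≤ n<c)
    where
    n<c : n < c
    n<c = ≰⇒> λ c≤n → <⇒≢ (m≤n⇒m*m<m*n+n*n 0<n c≤n) c²≡cn+n²
  ... | e , refl = rec e<n {n} 0<e (sym ne+e²≡n²)
    where
    ne+e²≡n² : n * e + e * e ≡ n * n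
    ne+e²≡n² = +-cancelˡ-≡ (n * n + n * e) _ _ (begin
      n * n + n * e + (n * e + e * e) ≡⟨ solve (n ∷ e ∷ []) ⟩
      (n + e) * (n + e)               ≡⟨ c²≡cn+n² ⟩
      (n + e) * n + n * n             ≡⟨ solve (n ∷ e ∷ []) ⟩
      n * n + n * e + n * n           ∎)
      where open ≡-Reasoning
    0<e : 0 < e
    0<e = n≢0⇒n>0 λ e≡0 →
      <⇒≢ (m≤n⇒m*m<m*n+n*n 0<n (≤-reflexive (trans (cong (λ k → n + k) e≡0) (+-identityʳ n)))) c²≡cn+n²
    e<n : e < n
    e<n = ≰⇒> λ n≤e → <⇒≢ (m≤n⇒m*m<m*n+n*n 0<e n≤e) (sym ne+e²≡n²)

-- φ² = φ + 1 in inequality form: x + m ≤ φx  iff  m ≤ x/φ.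
+≤φ·⇒ : ∀ {x m} → x + m ≤φ· x → x * m + m * m ≤ x * x
+≤φ·⇒ {x} {m} x+m≤φx = +-cancelˡ-≤ (x * x + x * m) _ _ (begin
  x * x + x * m + (x * m + m * m) ≡⟨ solve (x ∷ m ∷ []) ⟩
  (x + m) * (x + m)               ≤⟨ x+m≤φx ⟩
  (x + m) * x + x * x             ≡⟨ solve (x ∷ m ∷ []) ⟩
  x * x + x * m + x * x           ∎)
  where open ≤-Reasoning

+>φ·⇒ : ∀ {x m} → x + m >φ· x → x * x < x * m + m * m
+>φ·⇒ {x} {m} x+m>φx = +-cancelˡ-< (x * x + x * m) _ _ (begin-strict
  x * x + x * m + x * x           ≡⟨ solve (x ∷ m ∷ []) ⟩
  (x + m) * x + x * x             <⟨ x+m>φx ⟩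
  (x + m) * (x + m)               ≡⟨ solve (x ∷ m ∷ []) ⟩
  x * x + x * m + (x * m + m * m) ∎)
  where open ≤-Reasoning

1+2n>φ·n : ∀ n → 1 + 2 * n >φ· n
1+2n>φ·n n = begin-strict
  (1 + 2 * n) * n + n * n                         <⟨ m<m+n _ z<s ⟩
  (1 + 2 * n) * n + n * n + 1                     ≤⟨ m≤m+n _ (n * n + 3 * n) ⟩
  (1 + 2 * n) * n + n * n + 1 + (n * n + 3 * n)   ≡⟨ solve (n ∷ []) ⟩
  (1 + 2 * n) * (1 + 2 * n)                       ∎
  where open ≤-Reasoning

≤φ·⇒≤2* : ∀ {k n} → k ≤φ· n → k ≤ 2 * n
≤φ·⇒≤2* {k} {n} k≤φn =
  ≮⇒≥ λ 2n<k → ≤φ·⇒≯φ· {k} {n} k≤φn (>φ·-mono {1 + 2 * n} {k} {n} (1+2n>φ·n n) 2n<k)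

≤φ·-suc : ∀ {k n} → k ≤φ· n → suc k ≤φ· suc n
≤φ·-suc {k} {n} k≤φn = begin
  (1 + k) * (1 + k)                    ≡⟨ solve (k ∷ []) ⟩
  k * k + (k + (k + 1))                ≤⟨ +-mono-≤ k≤φn (+-monoʳ-≤ k k+1≤3n+2) ⟩
  k * n + n * n + (k + (3 * n + 2))    ≡⟨ solve (k ∷ n ∷ []) ⟩
  (1 + k) * (1 + n) + (1 + n) * (1 + n) ∎
  where
  open ≤-Reasoning
  k+1≤3n+2 : k + 1 ≤ 3 * n + 2
  k+1≤3n+2 = +-mono-≤ (≤-trans (≤φ·⇒≤2* {k} {n} k≤φn) (*-monoˡ-≤ n (m≤n+m 2 1))) (m≤n+m 1 1)

m<n⇒∃[o>0]m+o≡n : ∀ {m n} → m < n → ∃[ o ] 0 < o × m + o ≡ n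
m<n⇒∃[o>0]m+o≡n {m} m<n with m≤n⇒∃[o]m+o≡n m<n
... | o , refl = suc o , z<s , +-suc m o

search-down : ∀ {P : ℕ → Set} → Decidable P → ∀ {N} → P N →
              ∃[ k ] P k × (∀ {j} → k ≡ suc j → ¬ P j)
search-down P? {zero} pN = 0 , pN , λ ()
search-down P? {suc N} pN with P? N
... | yes pN′ = search-down P? pN′
... | no ¬pN′ = suc N , pN , λ { refl → ¬pN′ }

IsFloorφ : ℕ → ℕ → Set
IsFloorφ n k = k ≤φ· n × suc k >φ· n

floorφ-exists : ∀ n → ∃ (IsFloorφ n)
floorφ-exists n
  with search-down {λ k → suc k >φ· n} (λ k → suc k * n + n * n <? suc k * suc k) {2 * n} (1+2n>φ·n n)
... | zero  , 1>φn   , _      = 0 , z≤n , 1>φn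
... | suc k , 2+k>φn , minimal = suc k , ≮⇒≥ (minimal refl) , 2+k>φn

-- Abstract, so that unification never unfolds the search.
abstract
  floorφ : ℕ → ℕ
  floorφ n = proj₁ (floorφ-exists n)

  floorφ-spec : ∀ n → IsFloorφ n (floorφ n)
  floorφ-spec n = proj₂ (floorφ-exists n)

≤φ·⇒≤floorφ : ∀ {k n} → k ≤φ· n → k ≤ floorφ n
≤φ·⇒≤floorφ {k} {n} k≤φn =
  ≮⇒≥ λ floor<k → ≤φ·⇒≯φ· {k} {n} k≤φn (>φ·-mono {suc (floorφ n)} {k} {n} (proj₂ (floorφ-spec n)) floor<k)

floorφ-unique : ∀ {n k} → IsFloorφ n k → floorφ n ≡ k
floorφ-unique {n} {k} (k≤φn , 1+k>φn) with <-cmp (floorφ n) k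
... | tri≈ _ eq _ = eq
... | tri< floor<k _ _ = contradiction floor<k (≤⇒≯ (≤φ·⇒≤floorφ {k} {n} k≤φn))
... | tri> _ _ k<floor = contradiction (>φ·-mono {suc k} {floorφ n} {n} 1+k>φn k<floor)
                                       (≤φ·⇒≯φ· {floorφ n} {n} (proj₁ (floorφ-spec n)))

floorφ-<-suc : ∀ n → floorφ n < floorφ (suc n)
floorφ-<-suc n = ≤φ·⇒≤floorφ {suc (floorφ n)} {suc n} (≤φ·-suc {floorφ n} {n} (proj₁ (floorφ-spec n)))

floorφ-mono-< : ∀ {m n} → m < n → floorφ m < floorφ n
floorφ-mono-< {m} {suc n} (s≤s m≤n) with m≤n⇒m<n∨m≡n m≤n
... | inj₁ m<n  = <-trans (floorφ-mono-< m<n) (floorφ-<-suc n)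
... | inj₂ refl = floorφ-<-suc m

floorφ-mono-≤ : ∀ {m n} → m ≤ n → floorφ m ≤ floorφ n
floorφ-mono-≤ m≤n with m≤n⇒m<n∨m≡n m≤n
... | inj₁ m<n  = <⇒≤ (floorφ-mono-< m<n)
... | inj₂ refl = ≤-refl

floorφ-cancel-< : ∀ {m n} → floorφ m < floorφ n → m < n
floorφ-cancel-< {m} {n} fm<fn = ≰⇒> λ n≤m → <⇒≱ fm<fn (floorφ-mono-≤ n≤m)

floorφ-injective : ∀ {m n} → floorφ m ≡ floorφ n → m ≡ n
floorφ-injective {m} {n} eq with <-cmp m n
... | tri≈ _ m≡n _ = m≡n
... | tri< m<n _ _ = contradiction eq (<⇒≢ (floorφ-mono-< m<n))
... | tri> _ _ n<m = contradiction (sym eq) (<⇒≢ (floorφ-mono-< n<m))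

IsFloorφ-disjoint : ∀ {n m j} → 0 < m → IsFloorφ m j → ¬ IsFloorφ n (j + m)
IsFloorφ-disjoint {n} {m} {j} 0<m (j≤φm , 1+j>φm) (j+m≤φn , 1+j+m>φn) =
  <-asym 1+j>φm (+>φ·⇒ {suc j} {m} (>φ·-antimonoʳ {suc (j + m)} {n} {suc j} 1+j+m>φn j<n))
  where
  j²<jm+m² : j * j < j * m + m * m
  j²<jm+m² = ≤∧≢⇒< j≤φm (φ-irrational m {j} 0<m)
  j<n : j < n
  j<n = ≰⇒> λ n≤j → <⇒≱ j²<jm+m² (+≤φ·⇒ {j} {m} (≤φ·-monoʳ {j + m} {n} {j} j+m≤φn n≤j))

floorφ≢floorφ+ : ∀ n {m} → 0 < m → floorφ n ≢ floorφ m + m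
floorφ≢floorφ+ n {m} 0<m eq =
  IsFloorφ-disjoint {n} {m} {floorφ m} 0<m (floorφ-spec m) (subst (IsFloorφ n) eq (floorφ-spec n))

-- With n least such that k + 1 ≤ φ(n + 1): either k = ⌊φn⌋, or k = n + m with n = ⌊φm⌋.
floorφ-cover : ∀ k → ∃[ n ] (k ≡ floorφ n ⊎ (0 < n × k ≡ floorφ n + n))
floorφ-cover k with search-down {λ n → suc k ≤φ· suc n} (λ n → _ ≤? _) {k} (m≤m+n _ _)
... | n , 1+k≤φ1+n , minimal with k * k ≤? k * n + n * n
...   | yes k≤φn = n , inj₁ (sym (floorφ-unique (k≤φn , 1+k>φ· minimal)))
  where
  1+k>φ· : ∀ {n} → (∀ {j} → n ≡ suc j → ¬ suc k ≤φ· suc j) → suc k >φ· n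
  1+k>φ· {zero}  _       = ≤-<-trans (≤-reflexive (trans (+-identityʳ _) (*-zeroʳ (suc k)))) z<s
  1+k>φ· {suc j} minimal = ≰⇒> (minimal refl)
...   | no k≰φn with m<n⇒∃[o>0]m+o≡n (>φ·⇒> {k} {n} (≰⇒> k≰φn))
...     | m , 0<m , refl = m , inj₂ (0<m , cong (_+ m) (sym (floorφ-unique (n≤φm , 1+n>φm))))
  where
  n≤φm : n ≤φ· m
  n≤φm = <⇒≤ (+>φ·⇒ {n} {m} (≰⇒> k≰φn))
  1+n>φm : suc n >φ· m
  1+n>φm = ≤∧≢⇒< (+≤φ·⇒ {suc n} {m} 1+k≤φ1+n) (≢-sym (φ-irrational m {suc n} 0<m))

[+a]-[+n]-cases : ∀ a n → (a ≤ n × + a ℤ.- + n ℤ.≤ + 0) ⊎ ∃[ e ] (a ≡ n + e × + a ℤ.- + n ≡ + e)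
[+a]-[+n]-cases a n with ≤-total a n
... | inj₁ a≤n = inj₁ (a≤n , ℤ.i≤j⇒i-j≤0 (+≤+ a≤n))
... | inj₂ n≤a with m≤n⇒∃[o]m+o≡n n≤a
...   | e , refl = inj₂ (e , refl , +n+e-+n)
  where
  +n+e-+n : + (n + e) ℤ.- + n ≡ + e
  +n+e-+n = begin
    + (n + e) ℤ.- + n ≡⟨ ℤ.[+m]-[+n]≡m⊖n (n + e) n ⟩
    (n + e) ⊖ n       ≡⟨ cong ((n + e) ⊖_) (sym (+-identityʳ n)) ⟩
    (n + e) ⊖ (n + 0) ≡⟨ ℤ.+-cancelˡ-⊖ n e 0 ⟩
    + e               ∎
    where open ≡-Reasoning

LeSqrt5-+ : ∀ e n → LeSqrt5 (+ e) n ⇔ e * e ≤ 5 * n * n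
LeSqrt5-+ e n = mk⇔ to (λ e²≤5n² → inj₂ (subst (ℤ._≤ _) (ℤ.pos-* e e) (+≤+ e²≤5n²)))
  where
  to : LeSqrt5 (+ e) n → e * e ≤ 5 * n * n
  to (inj₁ (+≤+ e≤0)) = ≤-trans (*-monoˡ-≤ e e≤0) z≤n
  to (inj₂ e²≤5n²)    = ℤ.drop‿+≤+ (subst (ℤ._≤ _) (sym (ℤ.pos-* e e)) e²≤5n²)

LtSqrt5-+ : ∀ n e → LtSqrt5 n (+ e) ⇔ 5 * n * n < e * e
LtSqrt5-+ n e = mk⇔ (λ (_ , 5n²<e²) → ℤ.drop‿+<+ (subst (_ ℤ.<_) (sym (ℤ.pos-* e e)) 5n²<e²)) from
  where
  from : 5 * n * n < e * e → LtSqrt5 n (+ e)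
  from 5n²<e² = +<+ (*-cancelʳ-< e 0 e (≤-<-trans z≤n 5n²<e²)) ,
                subst (_ ℤ.<_) (ℤ.pos-* e e) (+<+ 5n²<e²)

-- With 2K = n + e, the defining inequalities of φ scale by 4 to e² ≤ 5n² (resp. 5n² < e²).
module _ {K n e : ℕ} (2K≡n+e : 2 * K ≡ n + e) where

  private
    4K² : 4 * (K * K) ≡ n * n + 2 * n * e + e * e
    4K² = begin
      4 * (K * K)                 ≡⟨ solve (K ∷ []) ⟩
      (2 * K) * (2 * K)           ≡⟨ cong₂ _*_ 2K≡n+e 2K≡n+e ⟩
      (n + e) * (n + e)           ≡⟨ solve (n ∷ e ∷ []) ⟩
      n * n + 2 * n * e + e * e   ∎
      where open ≡-Reasoning

    4[Kn+n²] : 4 * (K * n + n * n) ≡ n * n + 2 * n * e + 5 * n * n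
    4[Kn+n²] = begin
      4 * (K * n + n * n)           ≡⟨ solve (K ∷ n ∷ []) ⟩
      2 * (2 * K) * n + 4 * (n * n) ≡⟨ cong (λ a → 2 * a * n + 4 * (n * n)) 2K≡n+e ⟩
      2 * (n + e) * n + 4 * (n * n) ≡⟨ solve (n ∷ e ∷ []) ⟩
      n * n + 2 * n * e + 5 * n * n ∎
      where open ≡-Reasoning

  ≤φ·⇔e²≤5n² : K ≤φ· n ⇔ e * e ≤ 5 * n * n
  ≤φ·⇔e²≤5n² = mk⇔
    (λ K≤φn → +-cancelˡ-≤ (n * n + 2 * n * e) _ _ (subst₂ _≤_ 4K² 4[Kn+n²] (*-monoʳ-≤ 4 K≤φn)))
    (λ e²≤5n² → *-cancelˡ-≤ 4 (subst₂ _≤_ (sym 4K²) (sym 4[Kn+n²]) (+-monoʳ-≤ (n * n + 2 * n * e) e²≤5n²)))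

  >φ·⇔5n²<e² : K >φ· n ⇔ 5 * n * n < e * e
  >φ·⇔5n²<e² = mk⇔
    (λ K>φn → +-cancelˡ-< (n * n + 2 * n * e) _ _ (subst₂ _<_ 4[Kn+n²] 4K² (*-monoʳ-< 4 K>φn)))
    (λ 5n²<e² → *-cancelˡ-< 4 _ _ (subst₂ _<_ (sym 4[Kn+n²]) (sym 4K²) (+-monoʳ-< (n * n + 2 * n * e) 5n²<e²)))

LeSqrt5⇔≤φ· : ∀ K n → LeSqrt5 (+ (2 * K) ℤ.- + n) n ⇔ K ≤φ· n
LeSqrt5⇔≤φ· K n with [+a]-[+n]-cases (2 * K) n
... | inj₁ (2K≤n , 2K-n≤0) =
  mk⇔ (λ _ → ≤-trans (*-monoʳ-≤ K (≤-trans (m≤n*m K 2) 2K≤n)) (m≤m+n (K * n) (n * n))) (λ _ → inj₁ 2K-n≤0)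
... | inj₂ (e , 2K≡n+e , 2K-n≡e) rewrite 2K-n≡e =
  ⇔.trans (LeSqrt5-+ e n) (⇔.sym (≤φ·⇔e²≤5n² {K} {n} {e} 2K≡n+e))

LtSqrt5⇔>φ· : ∀ K n → LtSqrt5 n (+ (2 * K) ℤ.- + n) ⇔ K >φ· n
LtSqrt5⇔>φ· K n with [+a]-[+n]-cases (2 * K) n
... | inj₁ (2K≤n , 2K-n≤0) =
  mk⇔ (λ (0<2K-n , _) → ⊥-elim (ℤ.<⇒≱ 0<2K-n 2K-n≤0))
      (λ K>φn → ⊥-elim (<⇒≱ (>φ·⇒> {K} {n} K>φn) (≤-trans (m≤n*m K 2) 2K≤n)))
... | inj₂ (e , 2K≡n+e , 2K-n≡e) rewrite 2K-n≡e =
  ⇔.trans (LtSqrt5-+ n e) (⇔.sym (>φ·⇔5n²<e² {K} {n} {e} 2K≡n+e))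

FloorPhi⇔IsFloorφ : ∀ n k → FloorPhi n k ⇔ IsFloorφ n k
FloorPhi⇔IsFloorφ n k = LeSqrt5⇔≤φ· k n ×-⇔
  subst (λ a → LtSqrt5 n (+ a ℤ.- + n) ⇔ suc k >φ· n) 2[1+k]≡2k+2 (LtSqrt5⇔>φ· (suc k) n)
  where
  2[1+k]≡2k+2 : 2 * (1 + k) ≡ 2 * k + 2
  2[1+k]≡2k+2 = solve (k ∷ [])

FloorPhi²-+ : ∀ n k → FloorPhi² n (k + n) ≡ FloorPhi n k
FloorPhi²-+ n k = cong₂ (λ z w → LeSqrt5 z n × LtSqrt5 n w)
  (trans (cong (λ a → + a ℤ.- + (3 * n)) 2[k+n]≡2n+2k) (shift (2 * k)))
  (trans (cong (λ a → + a ℤ.- + (3 * n)) 2[k+n]+2≡2n+[2k+2]) (shift (2 * k + 2)))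
  where
  2[k+n]≡2n+2k : 2 * (k + n) ≡ 2 * n + 2 * k
  2[k+n]≡2n+2k = solve (k ∷ n ∷ [])
  2[k+n]+2≡2n+[2k+2] : 2 * (k + n) + 2 ≡ 2 * n + (2 * k + 2)
  2[k+n]+2≡2n+[2k+2] = solve (k ∷ n ∷ [])
  3n≡2n+n : 3 * n ≡ 2 * n + n
  3n≡2n+n = solve (n ∷ [])
  shift : ∀ a → + (2 * n + a) ℤ.- + (3 * n) ≡ + a ℤ.- + n
  shift a = begin
    + (2 * n + a) ℤ.- + (3 * n) ≡⟨ ℤ.[+m]-[+n]≡m⊖n (2 * n + a) (3 * n) ⟩
    (2 * n + a) ⊖ (3 * n)       ≡⟨ cong ((2 * n + a) ⊖_) 3n≡2n+n ⟩
    (2 * n + a) ⊖ (2 * n + n)   ≡⟨ ℤ.+-cancelˡ-⊖ (2 * n) a n ⟩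
    a ⊖ n                       ≡⟨ ℤ.[+m]-[+n]≡m⊖n a n ⟨
    + a ℤ.- + n                 ∎
    where open ≡-Reasoning

FloorPhi²⇒≥ : ∀ {n a} → FloorPhi² n a → n ≤ a
FloorPhi²⇒≥ {n} {a} (_ , 0<2a+2-3n , _) =
  ≮⇒≥ λ a<n → ℤ.<⇒≱ 0<2a+2-3n (ℤ.i≤j⇒i-j≤0 (+≤+ (2a+2≤3n a<n)))
  where
  2a+2≤3n : a < n → 2 * a + 2 ≤ 3 * n
  2a+2≤3n a<n = begin
    2 * a + 2  ≡⟨ solve (a ∷ []) ⟩
    2 * (1 + a) ≤⟨ *-monoʳ-≤ 2 a<n ⟩
    2 * n      ≤⟨ *-monoˡ-≤ n (m≤m+n 2 1) ⟩
    3 * n      ∎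
    where open ≤-Reasoning

FloorPhi-floorφ : ∀ n → FloorPhi n (floorφ n)
FloorPhi-floorφ n = Equivalence.from (FloorPhi⇔IsFloorφ n (floorφ n)) (floorφ-spec n)

FloorPhi⇒≡floorφ : ∀ {n k} → FloorPhi n k → k ≡ floorφ n
FloorPhi⇒≡floorφ {n} {k} fk = sym (floorφ-unique (Equivalence.to (FloorPhi⇔IsFloorφ n k) fk))

FloorPhi²-floorφ : ∀ n → FloorPhi² n (floorφ n + n)
FloorPhi²-floorφ n = subst id (sym (FloorPhi²-+ n (floorφ n))) (FloorPhi-floorφ n)

FloorPhi²⇒≡floorφ+ : ∀ {n a} → FloorPhi² n a → a ≡ floorφ n + n
FloorPhi²⇒≡floorφ+ {n} {a} fa with m≤n⇒∃[o]m+o≡n (FloorPhi²⇒≥ {n} {a} fa)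
... | k , refl rewrite +-comm n k = cong (_+ n) (FloorPhi⇒≡floorφ (subst id (FloorPhi²-+ n k) fa))

private
  x≡x+j⇒j≡0 : ∀ {x j} → x ≡ x + j → j ≡ 0
  x≡x+j⇒j≡0 {x} {j} eq = sym (+-cancelˡ-≡ x 0 j (trans (+-identityʳ x) eq))

RN-nonzero : ∀ {i j} → RN-moves i j → 0 < i ⊎ 0 < j
RN-nonzero (inj₁ (_ , 0<j)) = inj₂ 0<j
RN-nonzero (inj₂ (_ , 0<i)) = inj₁ 0<i

RW-nonzero : ∀ {i j} → RW-moves i j → 0 < i ⊎ 0 < j
RW-nonzero (inj₁ (_ , 0<j))        = inj₂ 0<j
RW-nonzero (inj₂ (inj₁ (_ , 0<i))) = inj₁ 0<i
RW-nonzero (inj₂ (inj₂ (_ , 0<j))) = inj₂ 0<j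

RW-swap : ∀ {i j} → RW-moves i j → RW-moves j i
RW-swap (inj₁ vertical)                = inj₂ (inj₁ vertical)
RW-swap (inj₂ (inj₁ horizontal))       = inj₁ horizontal
RW-swap (inj₂ (inj₂ (refl , 0<j)))     = inj₂ (inj₂ (refl , 0<j))

Diagonal : ℕ → ℕ → Set
Diagonal s t = s ≡ t

Diagonal-independent : Independent (BaseMove RN-moves) Diagonal
Diagonal-independent refl (_ , _ , inj₁ (refl , 0<j) , s≡s′+0 , s≡s′+j) refl =
  <⇒≢ 0<j (+-cancelˡ-≡ _ 0 _ (trans (sym s≡s′+0) s≡s′+j))
Diagonal-independent refl (_ , _ , inj₂ (refl , 0<i) , s≡s′+i , s≡s′+0) refl =
  <⇒≢ 0<i (+-cancelˡ-≡ _ 0 _ (trans (sym s≡s′+0) s≡s′+i))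

Diagonal-absorbing : Absorbing Everywhere (BaseMove RN-moves) Diagonal
Diagonal-absorbing {s} {t} _ with <-cmp s t
... | tri≈ _ s≡t _ = inj₁ s≡t
... | tri< s<t _ _ with m<n⇒∃[o>0]m+o≡n s<t
...   | d , 0<d , refl = inj₂ (s , s , (0 , d , inj₁ (refl , 0<d) , sym (+-identityʳ s) , refl) , refl)
Diagonal-absorbing {s} {t} _ | tri> _ _ t<s with m<n⇒∃[o>0]m+o≡n t<s
...   | d , 0<d , refl = inj₂ (t , t , (d , 0 , inj₂ (refl , 0<d) , refl , sym (+-identityʳ t)) , refl)

WythoffPair : ℕ → ℕ → Set
WythoffPair s t = ∃[ n ] ((s ≡ floorφ n × t ≡ floorφ n + n) ⊎ (t ≡ floorφ n × s ≡ floorφ n + n))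

WythoffPair-swap : ∀ {s t} → WythoffPair s t → WythoffPair t s
WythoffPair-swap (n , inj₁ lower-upper) = n , inj₂ lower-upper
WythoffPair-swap (n , inj₂ upper-lower) = n , inj₁ upper-lower

floorφ+-injective : ∀ {m n} → floorφ m + m ≡ floorφ n + n → m ≡ n
floorφ+-injective {m} {n} eq with <-cmp m n
... | tri≈ _ m≡n _ = m≡n
... | tri< m<n _ _ = contradiction eq (<⇒≢ (+-mono-< (floorφ-mono-< m<n) m<n))
... | tri> _ _ n<m = contradiction (sym eq) (<⇒≢ (+-mono-< (floorφ-mono-< n<m) n<m))

floorφ≡floorφ+⇒≡0 : ∀ {n m} → floorφ n ≡ floorφ m + m → n ≡ 0 × m ≡ 0
floorφ≡floorφ+⇒≡0 {n} {zero} eq = floorφ-injective (trans eq (+-identityʳ _)) , refl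
floorφ≡floorφ+⇒≡0 {n} {suc m} eq = contradiction eq (floorφ≢floorφ+ n z<s)

-- A move from (⌊φn⌋ , ⌊φn⌋ + n) keeps a coordinate or, diagonally, the difference n,
-- and either determines the pair.
lower-upper-independent : ∀ {n s′ t′ i j} → RW-moves i j → WythoffPair s′ t′ →
                          floorφ n ≡ s′ + i → floorφ n + n ≡ t′ + j → ⊥
lower-upper-independent {n} (inj₁ (refl , 0<j)) (m , inj₁ (refl , refl)) eq₁ eq₂
  with floorφ-injective {n} {m} (trans eq₁ (+-identityʳ _))
... | refl = <⇒≢ 0<j (sym (x≡x+j⇒j≡0 eq₂))
lower-upper-independent {n} (inj₂ (inj₁ (refl , 0<i))) (m , inj₁ (refl , refl)) eq₁ eq₂
  with floorφ+-injective {n} {m} (trans eq₂ (+-identityʳ _))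
... | refl = <⇒≢ 0<i (sym (x≡x+j⇒j≡0 eq₁))
lower-upper-independent {n} {j = j} (inj₂ (inj₂ (refl , 0<j))) (m , inj₁ (refl , refl)) eq₁ eq₂
  with +-cancelˡ-≡ (floorφ m + j) n m (trans (cong (_+ n) (sym eq₁)) (trans eq₂ (xy∙z≈xz∙y (floorφ m) m j)))
... | refl = <⇒≢ 0<j (sym (x≡x+j⇒j≡0 eq₁))
lower-upper-independent {n} (inj₁ (refl , 0<j)) (m , inj₂ (refl , refl)) eq₁ eq₂
  with floorφ≡floorφ+⇒≡0 {n} {m} (trans eq₁ (+-identityʳ _))
... | refl , refl = <⇒≢ 0<j (+-cancelˡ-≡ (floorφ 0) 0 _ eq₂)
lower-upper-independent {n} {i = i} (inj₂ (inj₁ (refl , 0<i))) (m , inj₂ (refl , refl)) eq₁ eq₂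
  with floorφ≡floorφ+⇒≡0 {m} {n} (sym (trans eq₂ (+-identityʳ _)))
... | refl , refl = <⇒≢ 0<i (sym (x≡x+j⇒j≡0 (trans eq₁ (cong (_+ i) (+-identityʳ (floorφ 0))))))
lower-upper-independent {n} {j = j} (inj₂ (inj₂ (refl , 0<j))) (m , inj₂ (refl , refl)) eq₁ eq₂
  with m+n≡0⇒m≡0 m m+n≡0 | m+n≡0⇒n≡0 m m+n≡0
  where
  m+n≡0 : m + n ≡ 0
  m+n≡0 = +-cancelˡ-≡ (floorφ m + j) (m + n) 0 (begin
    floorφ m + j + (m + n) ≡⟨ rearrange (floorφ m) j m n ⟩
    floorφ m + m + j + n   ≡⟨ cong (_+ n) eq₁ ⟨
    floorφ n + n           ≡⟨ eq₂ ⟩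
    floorφ m + j           ≡⟨ +-identityʳ _ ⟨
    floorφ m + j + 0       ∎)
    where
    open ≡-Reasoning
    rearrange : ∀ x j m n → x + j + (m + n) ≡ x + m + j + n
    rearrange = solve-∀
... | refl | refl = <⇒≢ 0<j (sym (x≡x+j⇒j≡0 (trans eq₁ (cong (_+ j) (+-identityʳ (floorφ 0))))))

WythoffPair-independent : Independent (BaseMove RW-moves) WythoffPair
WythoffPair-independent (n , inj₁ (refl , refl)) (i , j , mv , eq₁ , eq₂) w′ =
  lower-upper-independent mv w′ eq₁ eq₂
WythoffPair-independent (n , inj₂ (refl , refl)) (i , j , mv , eq₁ , eq₂) w′ =
  lower-upper-independent (RW-swap mv) (WythoffPair-swap w′) eq₂ eq₁

above-diagonal-absorbing : ∀ s d → WythoffPair s (s + d) ⊎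
                           ∃₂ λ s′ t′ → BaseMove RW-moves s (s + d) s′ t′ × WythoffPair s′ t′
above-diagonal-absorbing s d with <-cmp s (floorφ d)
... | tri≈ _ s≡⌊φd⌋ _ = inj₁ (d , inj₁ (s≡⌊φd⌋ , cong (_+ d) s≡⌊φd⌋))
... | tri> _ _ ⌊φd⌋<s with m<n⇒∃[o>0]m+o≡n ⌊φd⌋<s
...   | i , 0<i , refl =
  inj₂ (floorφ d , floorφ d + d , (i , i , inj₂ (inj₂ (refl , 0<i)) , refl , xy∙z≈xz∙y (floorφ d) i d) ,
        (d , inj₁ (refl , refl)))
above-diagonal-absorbing s d | tri< s<⌊φd⌋ _ _ with floorφ-cover s
... | m , inj₁ s≡⌊φm⌋ with m<n⇒∃[o>0]m+o≡n (floorφ-cancel-< (subst (_< floorφ d) s≡⌊φm⌋ s<⌊φd⌋))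
...   | j , 0<j , refl =
  inj₂ (s , s + m , (0 , j , inj₁ (refl , 0<j) , sym (+-identityʳ s) , sym (+-assoc s m j)) ,
        (m , inj₁ (s≡⌊φm⌋ , cong (_+ m) s≡⌊φm⌋)))
above-diagonal-absorbing s d | tri< _ _ _ | m , inj₂ (0<m , s≡⌊φm⌋+m) =
  inj₂ (s , floorφ m , (0 , m + d , inj₁ (refl , <-≤-trans 0<m (m≤m+n m d)) , sym (+-identityʳ s) ,
                        trans (cong (_+ d) s≡⌊φm⌋+m) (+-assoc (floorφ m) m d)) ,
        (m , inj₂ (refl , s≡⌊φm⌋+m)))

WythoffPair-absorbing : Absorbing Everywhere (BaseMove RW-moves) WythoffPair
WythoffPair-absorbing {s} {t} _ with ≤-total s t
... | inj₁ s≤t with m≤n⇒∃[o]m+o≡n s≤t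
...   | d , refl = above-diagonal-absorbing s d
WythoffPair-absorbing {s} {t} _ | inj₂ t≤s with m≤n⇒∃[o]m+o≡n t≤s
...   | d , refl = transpose (above-diagonal-absorbing t d)
  where
  transpose : ∀ {s t} → WythoffPair s t ⊎ ∃₂ (λ s′ t′ → BaseMove RW-moves s t s′ t′ × WythoffPair s′ t′) →
              WythoffPair t s ⊎ ∃₂ (λ t′ s′ → BaseMove RW-moves t s t′ s′ × WythoffPair t′ s′)
  transpose (inj₁ w) = inj₁ (WythoffPair-swap w)
  transpose (inj₂ (s′ , t′ , (i , j , mv , eq₁ , eq₂) , w)) =
    inj₂ (t′ , s′ , (j , i , RW-swap mv , eq₂ , eq₁) , WythoffPair-swap w)

module LiftedKernels (p₁ q₁ p₂ q₂ D : ℕ) .{{_ : NonZero D}} (det : p₁ * q₂ ≡ q₁ * p₂ + D) where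

  open QCoordinates p₁ q₁ p₂ q₂ D det

  private
    diagonal-shift : ∀ x a c n → x + a * n + c * n ≡ x + n * (a + c)
    diagonal-shift = solve-∀

  Lift-Diagonal⇔RN-Set : ∀ X Y → Lift Diagonal X Y ⇔ RN-Set p₁ q₁ p₂ q₂ X Y
  Lift-Diagonal⇔RN-Set X Y = mk⇔
    (λ { (x , y , n , _ , T , refl , refl , refl) →
           x , y , n , Equivalence.to InT⇔InTQ T , diagonal-shift x p₁ p₂ n , diagonal-shift y q₁ q₂ n })
    (λ { (x , y , n , TQ , refl , refl) →
           x , y , n , n , Equivalence.from InT⇔InTQ TQ , refl ,
           sym (diagonal-shift x p₁ p₂ n) , sym (diagonal-shift y q₁ q₂ n) })

  Lift-WythoffPair⇔RW-Set : ∀ X Y → Lift WythoffPair X Y ⇔ RW-Set p₁ q₁ p₂ q₂ X Y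
  Lift-WythoffPair⇔RW-Set X Y = mk⇔ to from
    where
    to : Lift WythoffPair X Y → RW-Set p₁ q₁ p₂ q₂ X Y
    to (x , y , _ , _ , T , (n , inj₁ (refl , refl)) , refl , refl) =
      x , y , n , floorφ n + n , floorφ n , Equivalence.to InT⇔InTQ T ,
      FloorPhi²-floorφ n , FloorPhi-floorφ n , inj₂ (refl , refl)
    to (x , y , _ , _ , T , (n , inj₂ (refl , refl)) , refl , refl) =
      x , y , n , floorφ n + n , floorφ n , Equivalence.to InT⇔InTQ T ,
      FloorPhi²-floorφ n , FloorPhi-floorφ n , inj₁ (refl , refl)
    from : RW-Set p₁ q₁ p₂ q₂ X Y → Lift WythoffPair X Y
    from (x , y , n , a , b , TQ , φ²n , φn , placement)
      with FloorPhi²⇒≡floorφ+ {n} {a} φ²n | FloorPhi⇒≡floorφ {n} {b} φn | placement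
    ... | refl | refl | inj₁ (refl , refl) =
      x , y , floorφ n + n , floorφ n , Equivalence.from InT⇔InTQ TQ , (n , inj₂ (refl , refl)) , refl , refl
    ... | refl | refl | inj₂ (refl , refl) =
      x , y , floorφ n , floorφ n + n , Equivalence.from InT⇔InTQ TQ , (n , inj₁ (refl , refl)) , refl , refl

corollary1 : (p₁ q₁ p₂ q₂ : ℕ) → 0 < p₁ → 0 < q₂ → q₁ * p₂ < p₁ * q₂ →
    (∀ X Y → PPos p₁ q₁ p₂ q₂ RN-moves X Y ⇔ RN-Set p₁ q₁ p₂ q₂ X Y) ×
    (∀ X Y → PPos p₁ q₁ p₂ q₂ RW-moves X Y ⇔ RW-Set p₁ q₁ p₂ q₂ X Y)
corollary1 p₁ q₁ p₂ q₂ 0<p₁ 0<q₂ q₁p₂<p₁q₂ with m<n⇒∃[o>0]m+o≡n q₁p₂<p₁q₂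
... | D , 0<D , q₁p₂+D≡p₁q₂ =
  (λ X Y → ⇔.trans (Nim.PPos⇔Lift X Y) (Lift-Diagonal⇔RN-Set X Y)) ,
  (λ X Y → ⇔.trans (Wythoff.PPos⇔Lift X Y) (Lift-WythoffPair⇔RW-Set X Y))
  where
  instance
    D≢0 : NonZero D
    D≢0 = >-nonZero 0<D
  det : p₁ * q₂ ≡ q₁ * p₂ + D
  det = sym q₁p₂+D≡p₁q₂
  open LiftedKernels p₁ q₁ p₂ q₂ D det
  module Nim     = Lifting p₁ q₁ p₂ q₂ D det 0<p₁ 0<q₂
                          RN-moves RN-nonzero Diagonal Diagonal-independent Diagonal-absorbing
  module Wythoff = Lifting p₁ q₁ p₂ q₂ D det 0<p₁ 0<q₂
                          RW-moves RW-nonzero WythoffPair WythoffPair-independent WythoffPair-absorbing
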